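{- Let $\mathcal{P}$ be an autonomous poset and let $k$ be a maximal element of $\mathcal{P}$. Then $\mathcal{P}-k$ is an autonomous poset.
   Context: A simple pseudo-graph is a finite graph that may have loops but no multiple edges; its edge set $E(G)\subseteq V(G)\times V(G)$ is a symmetric relation, and $v$ is looped iff $vv\in E(G)$. Write $N(v)=\{w: vw\in E(G)\}$. An OSP-graph is a simple pseudo-graph whose vertex set is a finite set of positive integers with the usual order. Pressing a looped vertex $v$ produces $G_{(v)}$ with vertex set $V(G)$ and edge set $E(G)\,\triangle\,(N(v)\times N(v))$; $G_{(v_1,\dots,v_k)}$ denotes successive pressing. A successful pressing sequence is a sequence $(v_1,\dots,v_k)$ with each $v_i$ looped in $G_{(v_1,\dots,v_{i-1})}$ and $G_{(v_1,\dots,v_k)}$ having no edges and no loops; $\Sigma(G)$ is their set. $G$ is full-rank if its adjacency matrix (diagonal entry $1$ at looped vertices) is invertible over $\mathbb{F}_2$. For full-rank $G$ on $n$ vertices and $\sigma=(v_1,\dots,v_n)\in\Sigma(G)$, let $U$ be the upper-triangular $0/1$ matrix with $U[i,j]=1$ iff $i\le j$ and $v_iv_j\in E(G_{(v_1,\dots,v_{i-1})})$, $D$ the digraph on $V(G)$ with arc $v_i\to v_j$ whenever $U[i,j]=1$, and $\mathcal{P}(G,\sigma)=(V(G),\preceq)$ the instructional poset with $y\preceq x$ iff there is a directed path (possibly of length $0$) from $x$ to $y$ in $D$. A linear extension of a poset is a listing $(\tau_1,\dots,\tau_n)$ of its elements with $\tau_i\succ\tau_j\Rightarrow i<j$; $\mathrm{LinExt}(\mathcal{P})$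 is their set. A finite poset $\mathcal{P}$ is autonomous if there exist a full-rank OSP-graph $G$ and $\sigma\in\Sigma(G)$ with $\mathcal{P}(G,\sigma)$ isomorphic to $\mathcal{P}$ and $\Sigma(G)=\mathrm{LinExt}(\mathcal{P}(G,\sigma))$. $\mathcal{P}-k$ denotes the subposet on the remaining elements. -}

module Defs where

open import Data.Nat using (ℕ; suc)
open import Data.Bool using (Bool; true; false; _∧_; _xor_)
open import Data.Fin using (Fin; punchIn; _<_)
open import Data.Fin.Properties using () renaming (_≟_ to _≟ᶠ_)
open import Data.List using (List; []; _∷_; length; lookup; foldr; map; allFin)
open import Data.List.Membership.Propositional using (_∈_)
open import Data.List.Relation.Unary.Unique.Propositional using (Unique)
open import Data.Product using (Σ; _×_; _,_)
open import Data.Sum using (_⊎_)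
open import Data.Empty using (⊥)
open import Relation.Nullary using (¬_)
open import Relation.Binary.PropositionalEquality using (_≡_)
open import Relation.Binary.Structures using (IsPartialOrder)
open import Relation.Binary.Construct.Closure.ReflexiveTransitive using (Star)
open import Function.Bundles using (_↔_; Inverse)

-- A simple pseudo-graph on vertex set Fin n, given by its adjacency
-- (loop at v iff adj v v ≡ true).  Symmetry is required separately.
Adj : ℕ → Set
Adj n = Fin n → Fin n → Bool

SymmetricAdj : ∀ {n} → Adj n → Set
SymmetricAdj A = ∀ x y → A x y ≡ A y x

press : ∀ {n} → Adj n → Fin n → Adj n
press A v x y = A x y xor (A v x ∧ A v y)

Successful : ∀ {n} → Adj n → List (Fin n) → Set
Successful A []       = ∀ x y → A x y ≡ false
Successful A (v ∷ vs) = (A v v ≡ true) × Successful (press A v) vs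

sumF2 : List Bool → Bool
sumF2 = foldr _xor_ false

mulF2 : ∀ {n} → Adj n → Adj n → Adj n
mulF2 {n} A B x y = sumF2 (map (λ z → A x z ∧ B z y) (allFin n))

idF2 : ∀ {n} → Adj n
idF2 x y with x ≟ᶠ y
... | Relation.Nullary.yes _ = true
... | Relation.Nullary.no _  = false

FullRank : ∀ {n} → Adj n → Set
FullRank {n} A = Σ (Adj n) λ B →
  (∀ x y → mulF2 A B x y ≡ idF2 x y) × (∀ x y → mulF2 B A x y ≡ idF2 x y)

-- Arcs of the digraph D: x → y iff x = v_i, y = v_j with i ≤ j and
-- v_i v_j an edge of G pressed at v_1 … v_{i-1}.
Arc : ∀ {n} → Adj n → List (Fin n) → Fin n → Fin n → Set
Arc A []       x y = ⊥
Arc A (v ∷ vs) x y = (x ≡ v × y ∈ (v ∷ vs) × A v y ≡ true) ⊎ Arc (press A v) vs x y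

-- Instructional poset: Instr A σ a b  means  a ⪯ b, i.e. a directed path
-- (possibly of length 0) from b to a in D.
Instr : ∀ {n} → Adj n → List (Fin n) → Fin n → Fin n → Set
Instr A σ a b = Star (Arc A σ) b a

LinExt : ∀ {n} → (Fin n → Fin n → Set) → List (Fin n) → Set
LinExt {n} R τ =
  Unique τ × (∀ x → x ∈ τ) ×
  (∀ (i j : Fin (length τ)) →
     R (lookup τ j) (lookup τ i) → ¬ (lookup τ i ≡ lookup τ j) → i < j)

Isomorphic : ∀ {m n} → (Fin m → Fin m → Set) → (Fin n → Fin n → Set) → Set
Isomorphic {m} {n} R S = Σ (Fin m ↔ Fin n) λ f →
  ∀ x y → (R x y → S (Inverse.to f x) (Inverse.to f y))
        × (S (Inverse.to f x) (Inverse.to f y) → R x y)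

Autonomous : ∀ {n} → (Fin n → Fin n → Set) → Set
Autonomous {n} R =
  IsPartialOrder _≡_ R ×
  Σ ℕ λ m → Σ (Adj m) λ A →
    SymmetricAdj A × FullRank A ×
    Σ (List (Fin m)) λ σ →
      Successful A σ ×
      Isomorphic (Instr A σ) R ×
      (∀ τ → (Successful A τ → LinExt (Instr A σ) τ)
           × (LinExt (Instr A σ) τ → Successful A τ))

Maximal : ∀ {n} → (Fin n → Fin n → Set) → Fin n → Set
Maximal R k = ∀ y → R k y → y ≡ k

-- P − k : subposet on the remaining elements, reindexed by punchIn k.
Delete : ∀ {n} → (Fin (suc n) → Fin (suc n) → Set) → Fin (suc n) → Fin n → Fin n → Set
Delete R k x y = R (punchIn k x) (punchIn k y)

-- Transport the autonomy witness (G, σ) along the isomorphism; k becomes a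
-- maximal vertex of P(G, σ).  Nothing is adjacent to k when pressed before it
-- in σ (such an edge would be an arc into k), so pressing commutes and k may be
-- pressed first.  Pressing the looped vertex k isolates it, and deleting it
-- leaves G' = G_(k) − k, whose adjacency matrix is the Schur complement of the
-- invertible one, hence invertible.  Successful sequences of G' are those of G
-- starting with k with k dropped, linear extensions of P − k are those of P
-- starting with the maximal element k with k dropped, and P(G', σ − k) is the
-- subposet P − k; so (G', σ − k) witnesses that P − k is autonomous.
module Submission where

open import Defs
open import Algebra.Bundles using (CommutativeRing)
open import Data.Bool using (Bool; true; false; _∧_; _xor_)
open import Data.Bool.Properties
  using (xor-∧-commutativeRing; xor-same; xor-identityʳ; xor-assoc; ∧-comm; ∧-assoc; ∧-distribʳ-xor; ¬-not)
open import Data.Fin using (Fin; punchIn; punchOut; _<_) renaming (zero to fzero; suc to fsuc)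
open import Data.Fin.Permutation using (remove; punchIn-permute′; inverseˡ; inverseʳ)
open import Data.Fin.Properties using (punchIn-injective; punchInᵢ≢i; punchIn-punchOut) renaming (_≟_ to _≟ᶠ_)
open import Data.List using (List; []; _∷_; _++_; map; tabulate; length; lookup)
open import Data.List.Properties using (map-tabulate)
open import Data.List.Membership.Propositional using (_∈_)
open import Data.List.Membership.Propositional.Properties using (∈-map⁺; ∈-map⁻; ∈-insert; ∈-∃++; ∈-lookup)
open import Data.List.Relation.Unary.All as All using (All; []; _∷_)
open import Data.List.Relation.Unary.All.Properties as All using ()
open import Data.List.Relation.Unary.AllPairs as AllPairs using (AllPairs; []; _∷_)
open import Data.List.Relation.Unary.AllPairs.Properties as AllPairs using ()
open import Data.List.Relation.Unary.Any using (here; there; index)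
open import Data.List.Relation.Unary.Any.Properties using (lookup-index)
open import Data.List.Relation.Unary.Unique.Propositional using (Unique)
open import Data.List.Relation.Unary.Unique.Propositional.Properties as Unique using ()
open import Data.Nat using (ℕ; zero; suc; z<s; s<s; s<s⁻¹)
open import Data.Product using (∃; _×_; _,_; proj₁; proj₂)
open import Data.Product.Function.NonDependent.Propositional using (_×-⇔_)
open import Data.Sum using (_⊎_; inj₁; inj₂)
open import Data.Unit using (⊤; tt)
open import Function using (_∘_; id; case_of_; Inverse; _⇔_; mk⇔; Equivalence)
open import Function.Properties.Equivalence using () renaming (refl to ⇔-refl; sym to ⇔-sym)
open import Function.Construct.Composition using (_⇔-∘_)
open import Function.Related.Propositional using (module EquationalReasoning)
open import Relation.Binary.Construct.Closure.ReflexiveTransitive using (Star; ε; _◅_; gmap)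
open import Relation.Binary.PropositionalEquality
open import Relation.Binary.Structures using (IsPartialOrder)
open import Relation.Nullary using (yes; no; contradiction)

open import Algebra.Properties.Semiring.Sum (CommutativeRing.semiring xor-∧-commutativeRing)
  using (sum; sum-remove; ∑-distrib-+; *-distribˡ-sum; sum-cong-≗)
open import Algebra.Properties.CommutativeSemigroup (CommutativeRing.+-commutativeSemigroup xor-∧-commutativeRing)
  using (xy∙z≈xz∙y)

open Equivalence using (to; from)

private
  variable
    n : ℕ

_≐_ : Adj n → Adj n → Set
A ≐ B = ∀ x y → A x y ≡ B x y

transpose : Adj n → Adj n
transpose A x y = A y x

removeVertex : Adj (suc n) → Fin (suc n) → Adj n
removeVertex A k x y = A (punchIn k x) (punchIn k y)

Isolated : Adj n → Fin n → Set
Isolated A k = ∀ y → A k y ≡ false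

punchIn-view : (k x : Fin (suc n)) → x ≡ k ⊎ ∃ λ x′ → punchIn k x′ ≡ x
punchIn-view k x with x ≟ᶠ k
... | yes x≡k = inj₁ x≡k
... | no x≢k  = inj₂ (punchOut (x≢k ∘ sym) , punchIn-punchOut (x≢k ∘ sym))

press-symmetric : {A : Adj n} → SymmetricAdj A → ∀ v → SymmetricAdj (press A v)
press-symmetric {A = A} symA v x y = cong₂ _xor_ (symA x y) (∧-comm (A v x) (A v y))

press-cong : {A B : Adj n} → A ≐ B → ∀ v → press A v ≐ press B v
press-cong A≐B v x y = cong₂ _xor_ (A≐B x y) (cong₂ _∧_ (A≐B v x) (A≐B v y))

successful-cong : {A B : Adj n} → A ≐ B → ∀ vs → Successful A vs → Successful B vs
successful-cong A≐B []       s            x y = trans (sym (A≐B x y)) (s x y)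
successful-cong A≐B (v ∷ vs) (looped , s)   =
  trans (sym (A≐B v v)) looped , successful-cong (press-cong A≐B v) vs s

arc-cong : {A B : Adj n} → A ≐ B → ∀ vs {x y} → Arc A vs x y → Arc B vs x y
arc-cong A≐B (v ∷ vs) (inj₁ (x≡v , y∈ , vy)) = inj₁ (x≡v , y∈ , trans (sym (A≐B v _)) vy)
arc-cong A≐B (v ∷ vs) (inj₂ arc)             = inj₂ (arc-cong (press-cong A≐B v) vs arc)

press-row-nonadjacent : (A : Adj n) {u w : Fin n} → A u w ≡ false → ∀ y → press A u w y ≡ A w y
press-row-nonadjacent A {u} {w} uw y =
  trans (cong (λ b → A w y xor (b ∧ A u y)) uw) (xor-identityʳ (A w y))

press-looped-isolated : (A : Adj n) {k : Fin n} → A k k ≡ true → Isolated (press A k) k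
press-looped-isolated A {k} looped y = trans (cong (λ b → A k y xor (b ∧ A k y)) looped) (xor-same (A k y))

press-isolated : {A : Adj n} {k : Fin n} → SymmetricAdj A → Isolated A k → ∀ v → Isolated (press A v) k
press-isolated {A = A} {k} symA iso v y =
  cong₂ (λ p q → p xor (q ∧ A v y)) (iso y) (trans (symA v k) (iso v))

press-comm : {A : Adj n} → SymmetricAdj A → {u w : Fin n} → A u w ≡ false →
             press (press A u) w ≐ press (press A w) u
press-comm {A = A} symA {u} {w} uw x y = begin
  press A u x y xor (press A u w x ∧ press A u w y)
    ≡⟨ cong₂ (λ p q → press A u x y xor (p ∧ q)) (press-row-nonadjacent A uw x) (press-row-nonadjacent A uw y) ⟩
  (A x y xor (A u x ∧ A u y)) xor (A w x ∧ A w y)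
    ≡⟨ xy∙z≈xz∙y (A x y) _ _ ⟩
  (A x y xor (A w x ∧ A w y)) xor (A u x ∧ A u y)
    ≡⟨ cong₂ (λ p q → press A w x y xor (p ∧ q)) (press-row-nonadjacent A wu x) (press-row-nonadjacent A wu y) ⟨
  press A w x y xor (press A w u x ∧ press A w u y) ∎
  where
  open ≡-Reasoning
  wu = trans (symA w u) uw

RightInverseF2 : Adj n → Adj n → Set
RightInverseF2 A B = mulF2 A B ≐ idF2

sumF2-tabulate : (g : Fin n → Bool) → sumF2 (tabulate g) ≡ sum g
sumF2-tabulate {zero}  g = refl
sumF2-tabulate {suc n} g = cong (g fzero xor_) (sumF2-tabulate (g ∘ fsuc))

mulF2-sum : (A B : Adj n) (x y : Fin n) → mulF2 A B x y ≡ sum (λ z → A x z ∧ B z y)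
mulF2-sum A B x y = trans (cong sumF2 (map-tabulate id (λ z → A x z ∧ B z y))) (sumF2-tabulate (λ z → A x z ∧ B z y))

sum-punchIn : (k : Fin (suc n)) (g : Fin (suc n) → Bool) → sum (g ∘ punchIn k) ≡ g k xor sum g
sum-punchIn k g = sym (begin
  g k xor sum g                        ≡⟨ cong (g k xor_) (sum-remove {i = k} g) ⟩
  g k xor (g k xor sum (g ∘ punchIn k)) ≡⟨ xor-assoc (g k) (g k) _ ⟨
  (g k xor g k) xor sum (g ∘ punchIn k) ≡⟨ cong (_xor sum (g ∘ punchIn k)) (xor-same (g k)) ⟩
  sum (g ∘ punchIn k)                  ∎)
  where open ≡-Reasoning

idF2-refl : (x : Fin n) → idF2 x x ≡ true
idF2-refl x with x ≟ᶠ x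
... | yes _   = refl
... | no x≢x = contradiction refl x≢x

idF2-≡ : {x y : Fin n} → x ≡ y → idF2 x y ≡ true
idF2-≡ {x = x} refl = idF2-refl x

idF2-≢ : {x y : Fin n} → x ≢ y → idF2 x y ≡ false
idF2-≢ {x = x} {y} x≢y with x ≟ᶠ y
... | yes x≡y = contradiction x≡y x≢y
... | no _    = refl

idF2-sym : (x y : Fin n) → idF2 x y ≡ idF2 y x
idF2-sym x y = case x ≟ᶠ y of λ where
  (yes x≡y) → trans (idF2-≡ x≡y) (sym (idF2-≡ (sym x≡y)))
  (no x≢y)  → trans (idF2-≢ x≢y) (sym (idF2-≢ (x≢y ∘ sym)))

idF2-punchIn : (k : Fin (suc n)) (x y : Fin n) → idF2 (punchIn k x) (punchIn k y) ≡ idF2 x y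
idF2-punchIn k x y = case x ≟ᶠ y of λ where
  (yes x≡y) → trans (idF2-≡ (cong (punchIn k) x≡y)) (sym (idF2-≡ x≡y))
  (no x≢y)  → trans (idF2-≢ (x≢y ∘ punchIn-injective k x y)) (sym (idF2-≢ x≢y))

rightInverse-cong : {A A′ B B′ : Adj n} → A ≐ A′ → B ≐ B′ →
                    RightInverseF2 A B → RightInverseF2 A′ B′
rightInverse-cong {A = A} {A′} {B} {B′} A≐A′ B≐B′ AB x y = begin
  mulF2 A′ B′ x y              ≡⟨ mulF2-sum A′ B′ x y ⟩
  sum (λ z → A′ x z ∧ B′ z y) ≡⟨ sum-cong-≗ (λ z → cong₂ _∧_ (A≐A′ x z) (B≐B′ z y)) ⟨
  sum (λ z → A x z ∧ B z y)   ≡⟨ mulF2-sum A B x y ⟨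
  mulF2 A B x y                ≡⟨ AB x y ⟩
  idF2 x y                     ∎
  where open ≡-Reasoning

rightInverse-transpose : {A B : Adj n} → RightInverseF2 A B → RightInverseF2 (transpose B) (transpose A)
rightInverse-transpose {A = A} {B} AB x y = begin
  mulF2 (transpose B) (transpose A) x y ≡⟨ mulF2-sum (transpose B) (transpose A) x y ⟩
  sum (λ z → B z x ∧ A y z)            ≡⟨ sum-cong-≗ (λ z → ∧-comm (B z x) (A y z)) ⟩
  sum (λ z → A y z ∧ B z x)            ≡⟨ mulF2-sum A B y x ⟨
  mulF2 A B y x                         ≡⟨ AB y x ⟩
  idF2 y x                              ≡⟨ idF2-sym y x ⟩
  idF2 x y                              ∎
  where open ≡-Reasoning

-- The Schur complement of the pivot A k k = 1, computed as in Gaussian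
-- elimination: the only correction is the rank-one term A k x · B k y, which
-- appears twice and cancels in characteristic 2.
rightInverse-removeVertex-press : {A B : Adj (suc n)} {k : Fin (suc n)} → SymmetricAdj A → A k k ≡ true →
  RightInverseF2 A B → RightInverseF2 (removeVertex (press A k) k) (removeVertex B k)
rightInverse-removeVertex-press {A = A} {B} {k} symA looped AB x y = begin
  mulF2 (removeVertex (press A k) k) (removeVertex B k) x y
    ≡⟨ mulF2-sum (removeVertex (press A k) k) (removeVertex B k) x y ⟩
  sum (λ z → (A x′ (i z) xor (A k x′ ∧ A k (i z))) ∧ B (i z) y′)
    ≡⟨ sum-cong-≗ (λ z → expand (A x′ (i z)) (A k x′) (A k (i z)) (B (i z) y′)) ⟩
  sum (λ z → f (i z) xor (A k x′ ∧ g (i z)))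
    ≡⟨ ∑-distrib-+ (f ∘ i) (λ z → A k x′ ∧ g (i z)) ⟩
  sum (f ∘ i) xor sum (λ z → A k x′ ∧ g (i z))
    ≡⟨ cong (sum (f ∘ i) xor_) (*-distribˡ-sum (A k x′) (g ∘ i)) ⟨
  sum (f ∘ i) xor (A k x′ ∧ sum (g ∘ i))
    ≡⟨ cong₂ (λ p q → p xor (A k x′ ∧ q)) (sum-punchIn k f) (sum-punchIn k g) ⟩
  (f k xor sum f) xor (A k x′ ∧ (g k xor sum g))
    ≡⟨ cong₂ (λ p q → (f k xor p) xor (A k x′ ∧ (g k xor q))) Σf Σg ⟩
  (f k xor idF2 x y) xor (A k x′ ∧ (g k xor false))
    ≡⟨ cong₂ (λ p q → (p xor idF2 x y) xor (A k x′ ∧ q)) fk gk ⟩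
  (c xor idF2 x y) xor c
    ≡⟨ xy∙z≈xz∙y c (idF2 x y) c ⟩
  (c xor c) xor idF2 x y
    ≡⟨ cong (_xor idF2 x y) (xor-same c) ⟩
  idF2 x y ∎
  where
  open ≡-Reasoning
  i = punchIn k
  x′ = i x
  y′ = i y
  f g : Fin (suc _) → Bool
  f z = A x′ z ∧ B z y′
  g z = A k z ∧ B z y′
  c = A k x′ ∧ B k y′
  expand : ∀ a b b′ d → (a xor (b ∧ b′)) ∧ d ≡ (a ∧ d) xor (b ∧ (b′ ∧ d))
  expand a b b′ d = trans (∧-distribʳ-xor d a (b ∧ b′)) (cong ((a ∧ d) xor_) (∧-assoc b b′ d))
  Σf : sum f ≡ idF2 x y
  Σf = trans (sym (mulF2-sum A B x′ y′)) (trans (AB x′ y′) (idF2-punchIn k x y))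
  Σg : sum g ≡ false
  Σg = trans (sym (mulF2-sum A B k y′)) (trans (AB k y′) (idF2-≢ (punchInᵢ≢i k y ∘ sym)))
  fk : f k ≡ c
  fk = cong (_∧ B k y′) (symA x′ k)
  gk : g k xor false ≡ B k y′
  gk = trans (xor-identityʳ (g k)) (cong (_∧ B k y′) looped)

fullRank-removeVertex-press : {A : Adj (suc n)} {k : Fin (suc n)} → SymmetricAdj A → A k k ≡ true →
  FullRank A → FullRank (removeVertex (press A k) k)
fullRank-removeVertex-press {A = A} {k} symA looped (B , AB , BA) =
  removeVertex B k , rightInverse-removeVertex-press symA looped AB , B′A′
  where
  -- The left inverse comes from transposing: Bᵀ is a right inverse of the symmetric A.
  ABᵀ : RightInverseF2 A (transpose B)
  ABᵀ = rightInverse-cong (λ x y → symA y x) (λ _ _ → refl) (rightInverse-transpose {A = B} {A} BA)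
  A′Bᵀ′ : RightInverseF2 (removeVertex (press A k) k) (removeVertex (transpose B) k)
  A′Bᵀ′ = rightInverse-removeVertex-press symA looped ABᵀ
  B′A′ : RightInverseF2 (removeVertex B k) (removeVertex (press A k) k)
  B′A′ = rightInverse-cong (λ _ _ → refl) (λ x y → press-symmetric symA k _ _)
           (rightInverse-transpose {A = removeVertex (press A k) k} A′Bᵀ′)

PressingAvoids : Adj n → List (Fin n) → Fin n → Set
PressingAvoids A []       k = ⊤
PressingAvoids A (v ∷ vs) k = A v k ≡ false × PressingAvoids (press A v) vs k

adjacent⇒≢ : (A : Adj n) {v y w : Fin n} → A v y ≡ true → A v w ≡ false → y ≢ w
adjacent⇒≢ A vy vw refl with trans (sym vy) vw
... | ()

∈-∷-middle⁺ : {v y : Fin n} (pre : List (Fin n)) {post : List (Fin n)} →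
              y ∈ pre ++ post → y ∈ pre ++ v ∷ post
∈-∷-middle⁺ []        y∈         = there y∈
∈-∷-middle⁺ (x ∷ pre) (here y≡x)  = here y≡x
∈-∷-middle⁺ (x ∷ pre) (there y∈) = there (∈-∷-middle⁺ pre y∈)

∈-∷-middle⁻ : {v y : Fin n} (pre : List (Fin n)) {post : List (Fin n)} →
              y ∈ pre ++ v ∷ post → y ≢ v → y ∈ pre ++ post
∈-∷-middle⁻ []        (here y≡v)  y≢v = contradiction y≡v y≢v
∈-∷-middle⁻ []        (there y∈) _   = y∈
∈-∷-middle⁻ (x ∷ pre) (here y≡x)  _   = here y≡x
∈-∷-middle⁻ (x ∷ pre) (there y∈) y≢v = there (∈-∷-middle⁻ pre y∈ y≢v)

noArcInto⇒pressingAvoids : {A : Adj n} {k : Fin n} (pre : List (Fin n)) {post : List (Fin n)} →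
  All (_≢ k) pre → (∀ {v} → Arc A (pre ++ k ∷ post) v k → v ≡ k) → PressingAvoids A pre k
noArcInto⇒pressingAvoids []        []            _       = tt
noArcInto⇒pressingAvoids (v ∷ pre) (v≢k ∷ pre≢k) noArcIn =
  ¬-not (λ vk → v≢k (noArcIn (inj₁ (refl , ∈-insert (v ∷ pre) , vk)))) ,
  noArcInto⇒pressingAvoids pre pre≢k (noArcIn ∘ inj₂)

successful-moveToFront : {A : Adj n} {k : Fin n} → SymmetricAdj A → (pre : List (Fin n)) {post : List (Fin n)} →
  PressingAvoids A pre k → Successful A (pre ++ k ∷ post) → Successful A (k ∷ pre ++ post)
successful-moveToFront symA []        _            s = s
successful-moveToFront {A = A} {k} symA (v ∷ pre) {post} (vk , avoids) (loopedV , s)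
  with successful-moveToFront (press-symmetric symA v) pre avoids s
... | loopedK , s′ =
  trans (sym (press-row-nonadjacent A vk k)) loopedK ,
  trans (press-row-nonadjacent A (trans (symA k v) vk) v) loopedV ,
  successful-cong (press-comm symA vk) (pre ++ post) s′

arc-moveToFront : {A : Adj n} {k : Fin n} → SymmetricAdj A → (pre : List (Fin n)) {post : List (Fin n)} →
  PressingAvoids A pre k → ∀ {x y} → Arc A (pre ++ k ∷ post) x y ⇔ Arc A (k ∷ pre ++ post) x y
arc-moveToFront symA [] _ = ⇔-refl
arc-moveToFront {A = A} {k} symA (v ∷ pre) {post} (vk , avoids) {x} {y} = mk⇔ forth back
  where
  IH = arc-moveToFront (press-symmetric symA v) pre avoids {x} {y}
  kv : A k v ≡ false
  kv = trans (symA k v) vk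
  forth : Arc A (v ∷ pre ++ k ∷ post) x y → Arc A (k ∷ v ∷ pre ++ post) x y
  forth (inj₁ (x≡v , y∈ , vy)) =
    inj₂ (inj₁ (x≡v , ∈-∷-middle⁻ (v ∷ pre) y∈ (adjacent⇒≢ A vy vk) , trans (press-row-nonadjacent A kv y) vy))
  forth (inj₂ arc) with to IH arc
  ... | inj₁ (x≡k , y∈ , ky) = inj₁ (x≡k , ∈-∷-middle⁺ (k ∷ []) y∈ , trans (sym (press-row-nonadjacent A vk y)) ky)
  ... | inj₂ arc′            = inj₂ (inj₂ (arc-cong (press-comm symA vk) (pre ++ post) arc′))
  back : Arc A (k ∷ v ∷ pre ++ post) x y → Arc A (v ∷ pre ++ k ∷ post) x y
  back (inj₁ (x≡k , y∈ , ky)) =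
    inj₂ (from IH (inj₁ (x≡k , ∈-∷-middle⁻ (k ∷ []) y∈ (adjacent⇒≢ A ky kv) , trans (press-row-nonadjacent A vk y) ky)))
  back (inj₂ (inj₁ (x≡v , y∈ , vy))) = inj₁ (x≡v , ∈-∷-middle⁺ (v ∷ pre) y∈ , trans (sym (press-row-nonadjacent A kv y)) vy)
  back (inj₂ (inj₂ arc′))            = inj₂ (from IH (inj₂ (arc-cong (press-comm symA kv) (pre ++ post) arc′)))

arc-target∈ : {A : Adj n} (vs : List (Fin n)) {x y : Fin n} → Arc A vs x y → y ∈ vs
arc-target∈ (v ∷ vs) (inj₁ (_ , y∈ , _)) = y∈
arc-target∈ (v ∷ vs) (inj₂ arc)          = there (arc-target∈ vs arc)

successful-removeVertex : {A : Adj (suc n)} {k : Fin (suc n)} → SymmetricAdj A → Isolated A k →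
  ∀ vs → Successful A (map (punchIn k) vs) ⇔ Successful (removeVertex A k) vs
successful-removeVertex {A = A} {k} symA iso [] = mk⇔ (λ s x y → s (punchIn k x) (punchIn k y)) back
  where
  back : Successful (removeVertex A k) [] → Successful A []
  back s x y with punchIn-view k x | punchIn-view k y
  ... | inj₁ refl         | _                 = iso y
  ... | inj₂ _            | inj₁ refl         = trans (symA x k) (iso x)
  ... | inj₂ (x′ , refl) | inj₂ (y′ , refl) = s x′ y′
successful-removeVertex {k = k} symA iso (v ∷ vs) =
  ⇔-refl ×-⇔ successful-removeVertex (press-symmetric symA (punchIn k v)) (press-isolated symA iso (punchIn k v)) vs

arc-removeVertex : (A : Adj (suc n)) {k : Fin (suc n)} (vs : List (Fin n)) {x y : Fin n} →
  Arc A (map (punchIn k) vs) (punchIn k x) (punchIn k y) ⇔ Arc (removeVertex A k) vs x y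
arc-removeVertex A []       = mk⇔ (λ ()) (λ ())
arc-removeVertex A {k} (v ∷ vs) {x} {y} = mk⇔ forth back
  where
  IH = arc-removeVertex (press A (punchIn k v)) vs {x} {y}
  forth : Arc A (map (punchIn k) (v ∷ vs)) (punchIn k x) (punchIn k y) → Arc (removeVertex A k) (v ∷ vs) x y
  forth (inj₁ (x≡v , y∈ , vy)) = inj₁ (punchIn-injective k x v x≡v , ∈-punchIn⁻ y∈ , vy)
    where
    ∈-punchIn⁻ : ∀ {ws} → punchIn k y ∈ map (punchIn k) ws → y ∈ ws
    ∈-punchIn⁻ y∈ with ∈-map⁻ (punchIn k) y∈
    ... | y′ , y′∈ , y≡y′ = subst (_∈ _) (sym (punchIn-injective k y y′ y≡y′)) y′∈
  forth (inj₂ arc) = inj₂ (to IH arc)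
  back : Arc (removeVertex A k) (v ∷ vs) x y → Arc A (map (punchIn k) (v ∷ vs)) (punchIn k x) (punchIn k y)
  back (inj₁ (x≡v , y∈ , vy)) = inj₁ (cong (punchIn k) x≡v , ∈-map⁺ (punchIn k) y∈ , vy)
  back (inj₂ arc)             = inj₂ (from IH arc)

star-reflect : {I J : Set} {T : J → J → Set} {U : I → I → Set} (f : I → J) →
  (∀ {a b} → f a ≡ f b → a ≡ b) → (∀ {b c} → T (f b) c → ∃ λ c′ → f c′ ≡ c × U b c′) →
  ∀ {u w b a} → Star T u w → f b ≡ u → f a ≡ w → Star U b a
star-reflect f inj lift ε         fb≡u fa≡u = subst (Star _ _) (inj (trans fb≡u (sym fa≡u))) ε
star-reflect f inj lift (t ◅ ts) refl fa≡w with lift t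
... | c′ , refl , u = u ◅ star-reflect f inj lift ts refl fa≡w

star-press-removeVertex : (A : Adj (suc n)) (k : Fin (suc n)) (vs : List (Fin n)) {a b : Fin n} →
  Star (Arc (removeVertex (press A k) k) vs) b a ⇔ Star (Arc A (k ∷ map (punchIn k) vs)) (punchIn k b) (punchIn k a)
star-press-removeVertex A k vs =
  mk⇔ (gmap (punchIn k) (inj₂ ∘ from (arc-removeVertex (press A k) vs)))
      (λ path → star-reflect (punchIn k) (punchIn-injective k _ _) lift path refl refl)
  where
  lift : ∀ {b c} → Arc A (k ∷ map (punchIn k) vs) (punchIn k b) c →
         ∃ λ c′ → punchIn k c′ ≡ c × Arc (removeVertex (press A k) k) vs b c′
  lift (inj₁ (b≡k , _)) = contradiction b≡k (punchInᵢ≢i k _)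
  lift (inj₂ arc) with ∈-map⁻ (punchIn k) (arc-target∈ (map (punchIn k) vs) arc)
  ... | c′ , _ , refl = c′ , refl , to (arc-removeVertex (press A k) vs) arc

NotStrictlyBelow : (Fin n → Fin n → Set) → Fin n → Fin n → Set
NotStrictlyBelow R x y = R x y → y ≡ x

LinExt′ : (Fin n → Fin n → Set) → List (Fin n) → Set
LinExt′ R τ = Unique τ × (∀ x → x ∈ τ) × AllPairs (NotStrictlyBelow R) τ

IndexOrdered : (Fin n → Fin n → Set) → List (Fin n) → Set
IndexOrdered R τ = ∀ (i j : Fin (length τ)) → R (lookup τ j) (lookup τ i) → lookup τ i ≢ lookup τ j → i < j

allPairs⇒indexOrdered : {R : Fin n → Fin n → Set} (τ : List (Fin n)) →
  AllPairs (NotStrictlyBelow R) τ → IndexOrdered R τ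
allPairs⇒indexOrdered (x ∷ xs) _                fzero    fzero    _ x≢x = contradiction refl x≢x
allPairs⇒indexOrdered (x ∷ xs) _                fzero    (fsuc j) _ _   = z<s
allPairs⇒indexOrdered (x ∷ xs) (x⊀xs ∷ _)      (fsuc i) fzero    r ≢x  = contradiction (All.lookup x⊀xs (∈-lookup i) r) ≢x
allPairs⇒indexOrdered (x ∷ xs) (_ ∷ sorted)    (fsuc i) (fsuc j) r ≢  = s<s (allPairs⇒indexOrdered xs sorted i j r ≢)

indexOrdered⇒allPairs : {R : Fin n → Fin n → Set} (τ : List (Fin n)) →
  IndexOrdered R τ → AllPairs (NotStrictlyBelow R) τ
indexOrdered⇒allPairs []       _       = []
indexOrdered⇒allPairs {R = R} (x ∷ xs) ordered =
  All.tabulate x⊀ ∷ indexOrdered⇒allPairs xs (λ i j r ≢ → s<s⁻¹ (ordered (fsuc i) (fsuc j) r ≢))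
  where
  x⊀ : ∀ {y} → y ∈ xs → NotStrictlyBelow R x y
  x⊀ {y} y∈ r with y ≟ᶠ x
  ... | yes y≡x = y≡x
  ... | no y≢x with ordered (fsuc (index y∈)) fzero (subst (R x) (lookup-index y∈) r)
                          (subst (_≢ x) (lookup-index y∈) y≢x)
  ...   | ()

linExt⇔linExt′ : {R : Fin n → Fin n → Set} (τ : List (Fin n)) → LinExt R τ ⇔ LinExt′ R τ
linExt⇔linExt′ τ = ⇔-refl ×-⇔ ⇔-refl ×-⇔ mk⇔ (indexOrdered⇒allPairs τ) (allPairs⇒indexOrdered τ)

linExt′-cons-maximal : {P : Fin (suc n) → Fin (suc n) → Set} {Q : Fin n → Fin n → Set} {k : Fin (suc n)} →
  Maximal P k → (∀ a b → Q a b ⇔ P (punchIn k a) (punchIn k b)) →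
  ∀ τ → LinExt′ Q τ ⇔ LinExt′ P (k ∷ map (punchIn k) τ)
linExt′-cons-maximal {P = P} {Q} {k} maximal Q⇔P τ = mk⇔ forth back
  where
  forth : LinExt′ Q τ → LinExt′ P (k ∷ map (punchIn k) τ)
  forth (unique , cover , sorted) =
    (All.map⁺ (All.universal (λ x → punchInᵢ≢i k x ∘ sym) τ) ∷ Unique.map⁺ (punchIn-injective k _ _) unique) ,
    cover′ ,
    (All.universal maximal _ ∷ AllPairs.map⁺ (AllPairs.map (λ x⊀y r → cong (punchIn k) (x⊀y (from (Q⇔P _ _) r))) sorted))
    where
    cover′ : ∀ x → x ∈ k ∷ map (punchIn k) τ
    cover′ x with punchIn-view k x
    ... | inj₁ x≡k          = here x≡k
    ... | inj₂ (x′ , refl) = there (∈-map⁺ (punchIn k) (cover x′))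
  back : LinExt′ P (k ∷ map (punchIn k) τ) → LinExt′ Q τ
  back ((_ ∷ unique) , cover , (_ ∷ sorted)) =
    Unique.map⁻ unique ,
    cover′ ,
    AllPairs.map (λ x⊀y r → punchIn-injective k _ _ (x⊀y (to (Q⇔P _ _) r))) (AllPairs.map⁻ sorted)
    where
    cover′ : ∀ x → x ∈ τ
    cover′ x with cover (punchIn k x)
    ... | here x≡k = contradiction x≡k (punchInᵢ≢i k x)
    ... | there x∈ with ∈-map⁻ (punchIn k) x∈
    ...   | x′ , x′∈ , x≡x′ = subst (_∈ τ) (sym (punchIn-injective k x x′ x≡x′)) x′∈

SequencesAreLinExts : Adj n → List (Fin n) → Set
SequencesAreLinExts A σ =
  ∀ τ → (Successful A τ → LinExt (Instr A σ) τ) × (LinExt (Instr A σ) τ → Successful A τ)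

Unique-++-∷⇒All-≢ : {k : Fin n} (pre : List (Fin n)) {post : List (Fin n)} →
  Unique (pre ++ k ∷ post) → All (_≢ k) (pre ++ post)
Unique-++-∷⇒All-≢ []        (k∉post ∷ _)      = All.map (λ k≢x x≡k → k≢x (sym x≡k)) k∉post
Unique-++-∷⇒All-≢ (v ∷ pre) (v∉rest ∷ unique) = All.lookup v∉rest (∈-insert pre) ∷ Unique-++-∷⇒All-≢ pre unique

All-≢⇒map-punchIn : (k : Fin (suc n)) (xs : List (Fin (suc n))) → All (_≢ k) xs →
  ∃ λ ys → map (punchIn k) ys ≡ xs
All-≢⇒map-punchIn k []       []            = [] , refl
All-≢⇒map-punchIn k (x ∷ xs) (x≢k ∷ xs≢k) with All-≢⇒map-punchIn k xs xs≢k
... | ys , refl = punchOut (x≢k ∘ sym) ∷ ys , cong (_∷ _) (punchIn-punchOut (x≢k ∘ sym))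

module DeleteMaximal {m : ℕ} {A : Adj (suc m)} (symA : SymmetricAdj A) (k : Fin (suc m))
  (pre post : List (Fin (suc m))) (successful : Successful A (pre ++ k ∷ post))
  (linExts : SequencesAreLinExts A (pre ++ k ∷ post)) (maximal : Maximal (Instr A (pre ++ k ∷ post)) k) where

  σ : List (Fin (suc m))
  σ = pre ++ k ∷ post

  unique : Unique σ
  unique = proj₁ (proj₁ (linExts σ) successful)

  others : All (_≢ k) (pre ++ post)
  others = Unique-++-∷⇒All-≢ pre unique

  avoids : PressingAvoids A pre k
  avoids = noArcInto⇒pressingAvoids pre (All.++⁻ˡ pre others) (λ arc → maximal _ (arc ◅ ε))

  successfulFront : Successful A (k ∷ pre ++ post)
  successfulFront = successful-moveToFront symA pre avoids successful

  looped : A k k ≡ true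
  looped = proj₁ successfulFront

  σ′ : List (Fin m)
  σ′ = proj₁ (All-≢⇒map-punchIn k (pre ++ post) others)

  σ′-punchIn : map (punchIn k) σ′ ≡ pre ++ post
  σ′-punchIn = proj₂ (All-≢⇒map-punchIn k (pre ++ post) others)

  A′ : Adj m
  A′ = removeVertex (press A k) k

  symmetric′ : SymmetricAdj A′
  symmetric′ x y = press-symmetric symA k _ _

  fullRank′ : FullRank A → FullRank A′
  fullRank′ = fullRank-removeVertex-press symA looped

  successful⇔ : ∀ τ → Successful A′ τ ⇔ Successful A (k ∷ map (punchIn k) τ)
  successful⇔ τ = mk⇔ (λ s → looped , from dropK s) (to dropK ∘ proj₂)
    where dropK = successful-removeVertex (press-symmetric symA k) (press-looped-isolated A looped) τ

  successful′ : Successful A′ σ′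
  successful′ = from (successful⇔ σ′) (subst (λ l → Successful A (k ∷ l)) (sym σ′-punchIn) successfulFront)

  instr⇔ : ∀ a b → Instr A′ σ′ a b ⇔ Instr A σ (punchIn k a) (punchIn k b)
  instr⇔ a b = front ⇔-∘ star-press-removeVertex A k σ′
    where
    front : Star (Arc A (k ∷ map (punchIn k) σ′)) (punchIn k b) (punchIn k a) ⇔ Instr A σ (punchIn k a) (punchIn k b)
    front rewrite σ′-punchIn =
      mk⇔ (gmap id (from (arc-moveToFront symA pre avoids))) (gmap id (to (arc-moveToFront symA pre avoids)))

  linExts′ : SequencesAreLinExts A′ σ′
  linExts′ τ = to equiv , from equiv
    where
    open EquationalReasoning
    equiv : Successful A′ τ ⇔ LinExt (Instr A′ σ′) τ
    equiv = begin
      Successful A′ τ                             ∼⟨ successful⇔ τ ⟩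
      Successful A (k ∷ map (punchIn k) τ)        ∼⟨ mk⇔ (proj₁ (linExts _)) (proj₂ (linExts _)) ⟩
      LinExt (Instr A σ) (k ∷ map (punchIn k) τ)  ∼⟨ linExt⇔linExt′ _ ⟩
      LinExt′ (Instr A σ) (k ∷ map (punchIn k) τ) ∼⟨ ⇔-sym (linExt′-cons-maximal maximal instr⇔ τ) ⟩
      LinExt′ (Instr A′ σ′) τ                     ∼⟨ ⇔-sym (linExt⇔linExt′ τ) ⟩
      LinExt (Instr A′ σ′) τ                      ∎

isPartialOrder-Delete : {R : Fin (suc n) → Fin (suc n) → Set} (k : Fin (suc n)) →
  IsPartialOrder _≡_ R → IsPartialOrder _≡_ (Delete R k)
isPartialOrder-Delete k po = record
  { isPreorder = record
    { isEquivalence = isEquivalence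
    ; reflexive     = λ { refl → IsPartialOrder.refl po }
    ; trans         = IsPartialOrder.trans po
    }
  ; antisym = λ r s → punchIn-injective k _ _ (IsPartialOrder.antisym po r s)
  }

maximal-transport : {m : ℕ} {P : Fin m → Fin m → Set} {R : Fin n → Fin n → Set}
  ((f , _) : Isomorphic P R) {k : Fin n} → Maximal R k → Maximal P (Inverse.from f k)
maximal-transport {R = R} (f , iso) {k} maximal y r =
  trans (sym (inverseˡ f)) (cong (Inverse.from f) (maximal _ (subst (λ z → R z _) (inverseʳ f) (proj₁ (iso _ y) r))))

isomorphic-delete : {m : ℕ} {P : Fin (suc m) → Fin (suc m) → Set} {R : Fin (suc n) → Fin (suc n) → Set}
  {Q : Fin m → Fin m → Set} ((f , _) : Isomorphic P R) (k : Fin (suc n)) →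
  (∀ a b → Q a b ⇔ P (punchIn (Inverse.from f k) a) (punchIn (Inverse.from f k) b)) →
  Isomorphic Q (Delete R k)
isomorphic-delete {R = R} (f , iso) k Q⇔P = remove (Inverse.from f k) f , λ x y →
  (λ q → subst₂ R (shift x) (shift y) (proj₁ (iso _ _) (to (Q⇔P x y) q))) ,
  (λ r → from (Q⇔P x y) (proj₂ (iso _ _) (subst₂ R (sym (shift x)) (sym (shift y)) r)))
  where shift = punchIn-permute′ f k

mainTheorem6 : ∀ {n} (R : Fin (suc n) → Fin (suc n) → Set) (k : Fin (suc n)) →
    Autonomous R → Maximal R k → Autonomous (Delete R k)
mainTheorem6 R k (_ , zero , _ , _ , _ , _ , _ , (f , _) , _) _ with Inverse.from f k
... | ()
mainTheorem6 R k (po , suc m , A , symA , fullRank , σ , successful , iso@(f , _) , linExts) maximal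
  with ∈-∃++ (proj₁ (proj₂ (proj₁ (linExts σ) successful)) (Inverse.from f k))
... | pre , post , refl =
  isPartialOrder-Delete k po , m , A′ , symmetric′ , fullRank′ fullRank , σ′ , successful′ ,
  isomorphic-delete {R = R} iso k instr⇔ , linExts′
  where open DeleteMaximal symA (Inverse.from f k) pre post successful linExts (maximal-transport {R = R} iso maximal)
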